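{- Let $G$ be a graph and $\ell\geqslant2$. Then $\chi(\mathbb{L}_\ell(G))\leqslant\lfloor\frac{2}{3}\chi(\mathbb{L}_{\ell-2}(G))\rfloor+1$.
   Context: All graphs are finite, undirected and loopless; parallel edges are allowed. For $\ell\geqslant0$, an $\ell$-arc of $G$ is a sequence $(v_0,e_1,v_1,\ldots,e_\ell,v_\ell)$ with each $e_i$ an edge with ends $v_{i-1},v_i$ and $e_i\neq e_{i+1}$; an $\ell$-link is an $\ell$-arc identified with its reverse. The $\ell$-link graph $\mathbb{L}_\ell(G)$ has vertex set the $\ell$-links of $G$, and $\ell$-links $L,R$ are joined by as many edges as there are $(\ell+1)$-links $[v_0,e_1,\ldots,e_{\ell+1},v_{\ell+1}]$ with $\{[v_0,\ldots,v_\ell],[v_1,\ldots,v_{\ell+1}]\}=\{L,R\}$. $\chi$ denotes the chromatic number. -}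

module Defs where

open import Data.Nat using (ℕ; suc; _≤_)
open import Data.Fin using (Fin; inject₁; opposite; toℕ)
open import Data.Fin.Base using () renaming (suc to fsuc)
open import Data.Product using (Σ; _×_; proj₁; proj₂)
open import Data.Sum using (_⊎_)
open import Relation.Binary.PropositionalEquality using (_≡_; _≢_)

-- A finite loopless multigraph with vertex set Fin n and edge set Fin m.
-- Edge e has (unordered) ends proj₁ (ends e), proj₂ (ends e).
record Graph (n m : ℕ) : Set where
  field
    ends     : Fin m → Fin n × Fin n
    loopless : ∀ e → proj₁ (ends e) ≢ proj₂ (ends e)
open Graph public

Joins : ∀ {n m} → Graph n m → Fin m → Fin n → Fin n → Set
Joins G e u v =
  (proj₁ (ends G e) ≡ u × proj₂ (ends G e) ≡ v) ⊎ (proj₁ (ends G e) ≡ v × proj₂ (ends G e) ≡ u)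

-- An ℓ-arc (v₀, e₁, v₁, …, e_ℓ, v_ℓ): vertex i is vs i (i = 0..ℓ), edge e_{i+1} is es i (i = 0..ℓ-1).
record Arc {n m : ℕ} (G : Graph n m) (ℓ : ℕ) : Set where
  field
    vs     : Fin (suc ℓ) → Fin n
    es     : Fin ℓ → Fin m
    joins  : ∀ (i : Fin ℓ) → Joins G (es i) (vs (inject₁ i)) (vs (fsuc i))
    nonrev : ∀ (i j : Fin ℓ) → toℕ j ≡ suc (toℕ i) → es i ≢ es j
open Arc public

IsReverse : ∀ {n m} {G : Graph n m} {ℓ} → Arc G ℓ → Arc G ℓ → Set
IsReverse A B = (∀ i → vs B i ≡ vs A (opposite i)) × (∀ i → es B i ≡ es A (opposite i))

IsInit : ∀ {n m} {G : Graph n m} {ℓ} → Arc G (suc ℓ) → Arc G ℓ → Set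
IsInit A L = (∀ i → vs L i ≡ vs A (inject₁ i)) × (∀ i → es L i ≡ es A (inject₁ i))

IsTail : ∀ {n m} {G : Graph n m} {ℓ} → Arc G (suc ℓ) → Arc G ℓ → Set
IsTail A R = (∀ i → vs R i ≡ vs A (fsuc i)) × (∀ i → es R i ≡ es A (fsuc i))

-- An ℓ-link is an ℓ-arc up to
-- reversal, so a colouring of ℓ-links is a colouring of ℓ-arcs invariant under
-- reversal.  Two ℓ-links are adjacent iff they are the two ℓ-sublinks of some
-- (ℓ+1)-link; by invariance it suffices to ask that the initial and final
-- ℓ-subarcs of every (ℓ+1)-arc get different colours.
record LinkColouring {n m : ℕ} (G : Graph n m) (ℓ k : ℕ) : Set where
  field
    colour    : Arc G ℓ → Fin k
    invariant : ∀ (A B : Arc G ℓ) → IsReverse A B → colour A ≡ colour B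
    proper    : ∀ (A : Arc G (suc ℓ)) (L R : Arc G ℓ) → IsInit A L → IsTail A R →
                colour L ≢ colour R

IsChromaticNumber : ∀ {n m} → Graph n m → ℕ → ℕ → Set
IsChromaticNumber G ℓ k = LinkColouring G ℓ k × (∀ j → LinkColouring G ℓ j → k ≤ j)

module Submission where

-- An ℓ-link (ℓ ≥ 2) contains three (ℓ-2)-sublinks: first, middle and last.
-- Given a proper a-colouring of 𝕃_{ℓ-2}(G) these receive colours x, y, z,
-- and two adjacent ℓ-links give colour triples of the form (x, y, z) and
-- (y, z, w) with y ≠ z.  So any rule turning colour triples into new
-- colours that is symmetric in the outer colours and separates such
-- overlapping triples produces a proper colouring of 𝕃_ℓ(G)
-- (liftColouring).  Encoding lo i ↦ 2i, hi i ↦ 2i+1 and shared ↦ ⌊2a/3⌋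
-- shows that ⌊2a/3⌋ + 1 colours suffice (thirdsRule); the theorem then
-- follows from minimality of χ(𝕃_ℓ(G)).

open import Data.Bool using (Bool; true; false; _∨_)
open import Data.Bool.Properties using (∨-comm; ∨-zeroʳ)
open import Data.Empty using (⊥; ⊥-elim)
open import Data.Unit using (tt)
open import Data.Fin using (Fin; inject₁; opposite; toℕ; fromℕ<)
  renaming (suc to fsuc; zero to fzero)
open import Data.Fin.Properties
  using (toℕ-injective; toℕ-inject₁; opposite-prop; toℕ<n; fromℕ<-cong; fromℕ<-injective)
open import Data.Nat using (ℕ; zero; suc; _≤_; _<_; _*_; _+_; _∸_; s≤s; _≡ᵇ_; NonZero)
open import Data.Nat.DivMod using (_/_; _%_; m*n/n≡m; /-monoˡ-≤; [m+kn]%n≡m%n)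
open import Data.Nat.Properties
  using ( +-∸-assoc; +-comm; *-comm; *-monoˡ-≤; *-cancelʳ-≡; suc-injective; 1+n≢n
        ; ≤-refl; ≤-reflexive; ≤-trans; <⇒≤; <-irrefl; n≤1+n; ≡ᵇ⇒≡; ≡⇒≡ᵇ; module ≤-Reasoning )
open import Data.Nat.Tactic.RingSolver using (solve-∀)
open import Data.Product using (Σ; _×_; _,_)
open import Data.Sum using (_⊎_; inj₁; inj₂; swap)
open import Function using (_∘_)
open import Relation.Nullary using (Dec; yes; no; contradiction)
open import Relation.Binary.PropositionalEquality
open import Defs

SameArc : ∀ {n m} {G : Graph n m} {ℓ} → Arc G ℓ → Arc G ℓ → Set
SameArc A B = (∀ i → vs A i ≡ vs B i) × (∀ i → es A i ≡ es B i)

∸-unfold : ∀ k t → t < k → k ∸ t ≡ suc (k ∸ suc t)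
∸-unfold (suc k) t (s≤s t≤k) = +-∸-assoc 1 t≤k

opposite-inject₁ : ∀ {k} (i : Fin k) → opposite (inject₁ i) ≡ fsuc (opposite i)
opposite-inject₁ fzero            = refl
opposite-inject₁ {suc k} (fsuc i) = cong inject₁ (opposite-inject₁ i)

opposite-consecutive : ∀ {k} (i j : Fin k) → toℕ j ≡ suc (toℕ i) →
                       toℕ (opposite i) ≡ suc (toℕ (opposite j))
opposite-consecutive {k} i j j≡1+i = begin
  toℕ (opposite i)        ≡⟨ opposite-prop i ⟩
  k ∸ suc (toℕ i)         ≡⟨ cong (k ∸_) (sym j≡1+i) ⟩
  k ∸ toℕ j               ≡⟨ ∸-unfold k (toℕ j) (toℕ<n j) ⟩
  suc (k ∸ suc (toℕ j))   ≡⟨ cong suc (sym (opposite-prop j)) ⟩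
  suc (toℕ (opposite j))  ∎
  where open ≡-Reasoning

module _ {n m : ℕ} {G : Graph n m} where

  initArc : ∀ {ℓ} → Arc G (suc ℓ) → Arc G ℓ
  initArc A = record
    { vs     = vs A ∘ inject₁
    ; es     = es A ∘ inject₁
    ; joins  = joins A ∘ inject₁
    ; nonrev = λ i j j≡1+i → nonrev A (inject₁ i) (inject₁ j)
        (trans (toℕ-inject₁ j) (trans j≡1+i (cong suc (sym (toℕ-inject₁ i)))))
    }

  tailArc : ∀ {ℓ} → Arc G (suc ℓ) → Arc G ℓ
  tailArc A = record
    { vs     = vs A ∘ fsuc
    ; es     = es A ∘ fsuc
    ; joins  = joins A ∘ fsuc
    ; nonrev = λ i j j≡1+i → nonrev A (fsuc i) (fsuc j) (cong suc j≡1+i)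
    }

  reverseArc : ∀ {ℓ} → Arc G ℓ → Arc G ℓ
  reverseArc A = record
    { vs     = vs A ∘ opposite
    ; es     = es A ∘ opposite
    ; joins  = λ i → subst (λ t → Joins G (es A (opposite i)) (vs A t) (vs A (inject₁ (opposite i))))
                       (sym (opposite-inject₁ i)) (swap (joins A (opposite i)))
    ; nonrev = λ i j j≡1+i e → nonrev A (opposite j) (opposite i)
                                 (opposite-consecutive i j j≡1+i) (sym e)
    }

  -- A link colouring only sees the vertex and edge sequences: both arcs
  -- have reverseArc A as their reverse.
  colour-ext : ∀ {ℓ k} (c : LinkColouring G ℓ k) {A B : Arc G ℓ} →
               SameArc A B → LinkColouring.colour c A ≡ LinkColouring.colour c B
  colour-ext c {A} {B} (same-vs , same-es) =
    trans (invariant A (reverseArc A) ((λ _ → refl) , (λ _ → refl)))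
          (sym (invariant B (reverseArc A) (same-vs ∘ opposite , same-es ∘ opposite)))
    where open LinkColouring c

  init-cong : ∀ {ℓ} {A B : Arc G (suc ℓ)} → SameArc A B → SameArc (initArc A) (initArc B)
  init-cong (same-vs , same-es) = same-vs ∘ inject₁ , same-es ∘ inject₁

  tail-cong : ∀ {ℓ} {A B : Arc G (suc ℓ)} → SameArc A B → SameArc (tailArc A) (tailArc B)
  tail-cong (same-vs , same-es) = same-vs ∘ fsuc , same-es ∘ fsuc

  sub-arcs-overlap : ∀ {ℓ} {A : Arc G (suc (suc ℓ))} {L R : Arc G (suc ℓ)} →
                     IsInit A L → IsTail A R → SameArc (tailArc L) (initArc R)
  sub-arcs-overlap (init-vs , init-es) (tail-vs , tail-es) =
    (λ i → trans (init-vs (fsuc i)) (sym (tail-vs (inject₁ i)))) ,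
    (λ i → trans (init-es (fsuc i)) (sym (tail-es (inject₁ i))))

  reverse-init : ∀ {ℓ} {A B : Arc G (suc ℓ)} → IsReverse A B → IsReverse (tailArc A) (initArc B)
  reverse-init {A = A} (rev-vs , rev-es) =
    (λ i → trans (rev-vs (inject₁ i)) (cong (vs A) (opposite-inject₁ i))) ,
    (λ i → trans (rev-es (inject₁ i)) (cong (es A) (opposite-inject₁ i)))

  reverse-tail : ∀ {ℓ} {A B : Arc G (suc ℓ)} → IsReverse A B → IsReverse (initArc A) (tailArc B)
  reverse-tail (rev-vs , rev-es) = rev-vs ∘ fsuc , rev-es ∘ fsuc

record ThreeWalkRule (a b : ℕ) : Set where
  field
    rule       : Fin a → Fin a → Fin a → Fin b
    symmetric  : ∀ x y z → rule x y z ≡ rule z y x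
    separating : ∀ x y z w → y ≢ z → rule x y z ≢ rule y z w

module _ {n m : ℕ} {G : Graph n m} where

  firstArc middleArc lastArc : ∀ {ℓ} → Arc G (suc (suc ℓ)) → Arc G ℓ
  firstArc  = initArc ∘ initArc
  middleArc = tailArc ∘ initArc
  lastArc   = tailArc ∘ tailArc

  liftColouring : ∀ {ℓ a b} → ThreeWalkRule a b → LinkColouring G ℓ a →
                  LinkColouring G (2 + ℓ) b
  liftColouring {ℓ} R c = record
    { colour = newColour ; invariant = newInvariant ; proper = newProper }
    where
    open ThreeWalkRule R
    open LinkColouring c

    newColour : Arc G (2 + ℓ) → Fin _
    newColour A = rule (colour (firstArc A)) (colour (middleArc A)) (colour (lastArc A))

    -- Reversal swaps the first and last sub-arcs and reverses the middle one.
    newInvariant : ∀ A B → IsReverse A B → newColour A ≡ newColour B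
    newInvariant A B rev = begin
      newColour A
        ≡⟨ symmetric _ _ _ ⟩
      rule (colour (lastArc A)) (colour (middleArc A)) (colour (firstArc A))
        ≡⟨ cong₂ (λ x y → rule x y (colour (firstArc A))) last≡first middle≡middle ⟩
      rule (colour (firstArc B)) (colour (middleArc B)) (colour (firstArc A))
        ≡⟨ cong (rule _ _) first≡last ⟩
      newColour B ∎
      where
      open ≡-Reasoning
      rev-tail : IsReverse (tailArc A) (initArc B)
      rev-tail = reverse-init {A = A} {B = B} rev
      rev-init : IsReverse (initArc A) (tailArc B)
      rev-init = reverse-tail {A = A} {B = B} rev
      last≡first : colour (lastArc A) ≡ colour (firstArc B)
      last≡first = invariant _ _ (reverse-init {A = tailArc A} {B = initArc B} rev-tail)
      middle≡middle : colour (middleArc A) ≡ colour (middleArc B)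
      middle≡middle = invariant _ _ (reverse-tail {A = tailArc A} {B = initArc B} rev-tail)
      first≡last : colour (firstArc A) ≡ colour (lastArc B)
      first≡last = invariant _ _ (reverse-tail {A = initArc A} {B = tailArc B} rev-init)

    -- Adjacent links give triples (x, y, z), (y, z, w), and y ≠ z because
    -- the middle and last sub-arcs of L are adjacent in 𝕃_ℓ(G).
    newProper : ∀ A L R → IsInit A L → IsTail A R → newColour L ≢ newColour R
    newProper A L R isInit isTail =
      subst₂ (λ y z → newColour L ≢ rule y z (colour (lastArc R))) middle≡first last≡middle
        (separating _ _ _ _ middle≢last)
      where
      overlapping : SameArc (tailArc L) (initArc R)
      overlapping = sub-arcs-overlap {A = A} {L = L} {R = R} isInit isTail
      middle≡first : colour (middleArc L) ≡ colour (firstArc R)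
      middle≡first = colour-ext c (init-cong {A = tailArc L} {B = initArc R} overlapping)
      last≡middle : colour (lastArc L) ≡ colour (middleArc R)
      last≡middle = colour-ext c (tail-cong {A = tailArc L} {B = initArc R} overlapping)
      middle≢last : colour (middleArc L) ≢ colour (lastArc L)
      middle≢last = proper (tailArc L) (middleArc L) (lastArc L)
                      ((λ _ → refl) , (λ _ → refl)) ((λ _ → refl) , (λ _ → refl))

data Residue3 : ℕ → Set where
  first  : ∀ i → Residue3 (i * 3)
  second : ∀ i → Residue3 (1 + i * 3)
  third  : ∀ i → Residue3 (2 + i * 3)

residue3 : ∀ y → Residue3 y
residue3 zero                = first 0
residue3 (suc zero)          = second 0
residue3 (suc (suc zero))    = third 0
residue3 (suc (suc (suc y))) with residue3 y
... | first i  = first (suc i)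
... | second i = second (suc i)
... | third i  = third (suc i)

residue3-first : ∀ k → residue3 (k * 3) ≡ first k
residue3-first zero    = refl
residue3-first (suc k) rewrite residue3-first k = refl

residue3-second : ∀ k → residue3 (1 + k * 3) ≡ second k
residue3-second zero    = refl
residue3-second (suc k) rewrite residue3-second k = refl

offsets-differ : ∀ n .{{_ : NonZero n}} r s i j → r % n ≢ s % n → r + i * n ≢ s + j * n
offsets-differ n r s i j r≢s e = r≢s (begin
  r % n            ≡⟨ sym ([m+kn]%n≡m%n r i n) ⟩
  (r + i * n) % n  ≡⟨ cong (_% n) e ⟩
  (s + j * n) % n  ≡⟨ [m+kn]%n≡m%n s j n ⟩
  s % n            ∎)
  where open ≡-Reasoning

data Colour : Set where
  lo hi  : ℕ → Colour
  shared : Colour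

occurs : ℕ → ℕ → ℕ → Bool
occurs v x z = (x ≡ᵇ v) ∨ (z ≡ᵇ v)

occurs-sym : ∀ v x z → occurs v x z ≡ occurs v z x
occurs-sym v x z = ∨-comm (x ≡ᵇ v) (z ≡ᵇ v)

occurs-sound : ∀ v x z → occurs v x z ≡ true → x ≡ v ⊎ z ≡ v
occurs-sound v x z o with x ≡ᵇ v | ≡ᵇ⇒≡ x v | z ≡ᵇ v | ≡ᵇ⇒≡ z v
... | true  | x≡v | _    | _   = inj₁ (x≡v tt)
... | false | _   | true | z≡v = inj₂ (z≡v tt)
occurs-sound v x z () | false | _ | false | _

occurs-false : ∀ v x z → occurs v x z ≡ false → z ≢ v
occurs-false v x z o z≡v with z ≡ᵇ v | ≡⇒≡ᵇ z v z≡v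
... | true | _ = contradiction (trans (sym o) (∨-zeroʳ (x ≡ᵇ v))) λ ()

-- The colour of a triple with middle colour 3i+2, given whether 3i and
-- 3i+1 occur among the outer colours: the slot of 3i if it is free, else
-- the slot of 3i+1 if it is free, else the shared colour.
slotChoice : Bool → Bool → ℕ → Colour
slotChoice false _     i = lo i
slotChoice true  false i = hi i
slotChoice true  true  _ = shared

recolour : ℕ → ℕ → ℕ → Colour
recolour x y z with residue3 y
... | first i  = lo i
... | second i = hi i
... | third i  = slotChoice (occurs (i * 3) x z) (occurs (1 + i * 3) x z) i

recolour-first : ∀ x k z → recolour x (k * 3) z ≡ lo k
recolour-first x k z rewrite residue3-first k = refl

recolour-second : ∀ x k z → recolour x (1 + k * 3) z ≡ hi k
recolour-second x k z rewrite residue3-second k = refl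

recolour-sym : ∀ x y z → recolour x y z ≡ recolour z y x
recolour-sym x y z with residue3 y
... | first i  = refl
... | second i = refl
... | third i  = cong₂ (λ b b′ → slotChoice b b′ i)
                   (occurs-sym (i * 3) x z) (occurs-sym (1 + i * 3) x z)

slotChoice-lo : ∀ b b′ i {k} → slotChoice b b′ i ≡ lo k → b ≡ false × i ≡ k
slotChoice-lo false _ i refl = refl , refl
slotChoice-lo true false i ()
slotChoice-lo true true  i ()

slotChoice-hi : ∀ b b′ i {k} → slotChoice b b′ i ≡ hi k → b′ ≡ false × i ≡ k
slotChoice-hi true  false i refl = refl , refl
slotChoice-hi false _     i ()
slotChoice-hi true  true  i ()

slotChoice-shared : ∀ b b′ i → slotChoice b b′ i ≡ shared → b ≡ true × b′ ≡ true
slotChoice-shared true  true  i refl = refl , refl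
slotChoice-shared false _     i ()
slotChoice-shared true  false i ()

recolour-lo : ∀ x y z {k} → recolour x y z ≡ lo k → y ≡ k * 3 ⊎ (y ≡ 2 + k * 3 × z ≢ k * 3)
recolour-lo x y z e with residue3 y | e
... | first i  | refl = inj₁ refl
... | third i  | e′ with slotChoice-lo _ _ i e′
...   | free , refl = inj₂ (refl , occurs-false (i * 3) x z free)

recolour-hi : ∀ x y z {k} → recolour x y z ≡ hi k → y ≡ 1 + k * 3 ⊎ (y ≡ 2 + k * 3 × z ≢ 1 + k * 3)
recolour-hi x y z e with residue3 y | e
... | second i | refl = inj₁ refl
... | third i  | e′ with slotChoice-hi _ _ i e′
...   | free , refl = inj₂ (refl , occurs-false (1 + i * 3) x z free)

recolour-shared : ∀ x y z → recolour x y z ≡ shared →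
                  Σ ℕ λ k → y ≡ 2 + k * 3 × (z ≡ k * 3 ⊎ z ≡ 1 + k * 3)
recolour-shared x y z e with residue3 y | e
... | third i  | e′ with slotChoice-shared _ _ i e′
...   | both₀ , both₁ = i , refl , outer (occurs-sound _ x z both₀) (occurs-sound _ x z both₁)
  where
  outer : x ≡ i * 3 ⊎ z ≡ i * 3 → x ≡ 1 + i * 3 ⊎ z ≡ 1 + i * 3 → z ≡ i * 3 ⊎ z ≡ 1 + i * 3
  outer (inj₂ z≡) _          = inj₁ z≡
  outer _         (inj₂ z≡)  = inj₂ z≡
  outer (inj₁ x≡) (inj₁ x≡′) = ⊥-elim (1+n≢n (trans (sym x≡′) x≡))

slot-clash : ∀ {v t y z : ℕ} → y ≡ v ⊎ (y ≡ t × z ≢ v) → z ≡ v ⊎ (z ≡ t × y ≢ v) → y ≡ z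
slot-clash (inj₁ y≡v)       (inj₁ z≡v)       = trans y≡v (sym z≡v)
slot-clash (inj₁ y≡v)       (inj₂ (_ , y≢v)) = ⊥-elim (y≢v y≡v)
slot-clash (inj₂ (_ , z≢v)) (inj₁ z≡v)       = ⊥-elim (z≢v z≡v)
slot-clash (inj₂ (y≡t , _)) (inj₂ (z≡t , _)) = trans y≡t (sym z≡t)

recolour-separating : ∀ x y z w → y ≢ z → recolour x y z ≢ recolour y z w
recolour-separating x y z w y≢z e =
  clash (recolour x y z) refl (trans (sym (recolour-sym y z w)) (sym e))
  where
  clash : ∀ c → recolour x y z ≡ c → recolour w z y ≡ c → ⊥
  clash (lo k) p q = y≢z (slot-clash (recolour-lo x y z p) (recolour-lo w z y q))
  clash (hi k) p q = y≢z (slot-clash (recolour-hi x y z p) (recolour-hi w z y q))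
  clash shared p q with recolour-shared x y z p | recolour-shared w z y q
  ... | k , _ , inj₁ z≡3k   | k′ , z≡3k′+2 , _ =
          offsets-differ 3 0 2 k k′ (λ ()) (trans (sym z≡3k) z≡3k′+2)
  ... | k , _ , inj₂ z≡3k+1 | k′ , z≡3k′+2 , _ =
          offsets-differ 3 1 2 k k′ (λ ()) (trans (sym z≡3k+1) z≡3k′+2)

encode : ℕ → Colour → ℕ
encode a (lo i) = i * 2
encode a (hi i) = 1 + i * 2
encode a shared = 2 * a / 3

shared? : ∀ c → Dec (c ≡ shared)
shared? (lo _) = no λ ()
shared? (hi _) = no λ ()
shared? shared = yes refl

-- Away from the shared colour the numbering is injective (parity separates
-- lo from hi).
encode-injective : ∀ a {c c′} → c ≢ shared → c′ ≢ shared → encode a c ≡ encode a c′ → c ≡ c′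
encode-injective a {lo i}   {lo j}   _ _ e = cong lo (*-cancelʳ-≡ i j 2 e)
encode-injective a {hi i}   {hi j}   _ _ e = cong hi (*-cancelʳ-≡ i j 2 (suc-injective e))
encode-injective a {lo i}   {hi j}   _ _ e = ⊥-elim (offsets-differ 2 0 1 i j (λ ()) e)
encode-injective a {hi i}   {lo j}   _ _ e = ⊥-elim (offsets-differ 2 1 0 i j (λ ()) e)
encode-injective a {shared} {_}      c≢ _ _ = ⊥-elim (c≢ refl)
encode-injective a {_}      {shared} _ c≢ _ = ⊥-elim (c≢ refl)

below-shared : ∀ {k m a} → k * 3 ≤ m * 2 → m ≤ a → k ≤ 2 * a / 3
below-shared {k} {m} {a} 3k≤2m m≤a = begin
  k          ≡⟨ sym (m*n/n≡m k 3) ⟩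
  k * 3 / 3  ≤⟨ /-monoˡ-≤ 3 (begin
                  k * 3  ≤⟨ 3k≤2m ⟩
                  m * 2  ≤⟨ *-monoˡ-≤ 2 m≤a ⟩
                  a * 2  ≡⟨ *-comm a 2 ⟩
                  2 * a  ∎) ⟩
  2 * a / 3  ∎
  where open ≤-Reasoning

-- The identities behind the bounds 3·2i ≤ 2·3i, 3(2i+1) < 2(3i+2) and
-- 3(2i+2) = 2(3i+3).
lo-scale : ∀ i → i * 2 * 3 ≡ i * 3 * 2
lo-scale = solve-∀

hi-scale : ∀ i → 1 + (1 + i * 2) * 3 ≡ (2 + i * 3) * 2
hi-scale = solve-∀

full-scale : ∀ i → (2 + i * 2) * 3 ≡ (3 + i * 3) * 2
full-scale = solve-∀

lo-below : ∀ {a} i → i * 3 < a → encode a (lo i) ≤ encode a shared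
lo-below i 3i<a = below-shared (≤-reflexive (lo-scale i)) (<⇒≤ 3i<a)

hi-below : ∀ {a} i → 1 + i * 3 < a → encode a (hi i) ≤ encode a shared
hi-below i 3i+1<a = below-shared (≤-trans (n≤1+n _) (≤-reflexive (hi-scale i))) 3i+1<a

full-below : ∀ {a} i → suc i * 3 ≤ a → encode a (hi i) < encode a shared
full-below i 3i+2<a = below-shared (≤-reflexive (full-scale i)) 3i+2<a

slotChoice-bound : ∀ {a} b b′ i → suc i * 3 ≤ a → encode a (slotChoice b b′ i) ≤ encode a shared
slotChoice-bound false _     i 3i+2<a = ≤-trans (n≤1+n _) (<⇒≤ (full-below i 3i+2<a))
slotChoice-bound true  false i 3i+2<a = <⇒≤ (full-below i 3i+2<a)
slotChoice-bound true  true  i _      = ≤-refl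

recolour-bound : ∀ {a} x y z → y < a → encode a (recolour x y z) ≤ encode a shared
recolour-bound x y z y<a with residue3 y
... | first i  = lo-below i y<a
... | second i = hi-below i y<a
... | third i  = slotChoice-bound (occurs (i * 3) x z) (occurs (1 + i * 3) x z) i y<a

-- The shared colour only arises when the last colour z lies in a complete
-- triple, so every triple with middle colour z is numbered below it.
shared-isolated : ∀ {a} x y z → recolour x y z ≡ shared → y < a →
                  ∀ u v → encode a (recolour u z v) < encode a shared
shared-isolated {a} x y z e y<a u v with recolour-shared x y z e
... | k , refl , inj₁ refl = subst (λ c → encode a c < encode a shared)
                               (sym (recolour-first u k v)) (<⇒≤ (full-below k y<a))
... | k , refl , inj₂ refl = subst (λ c → encode a c < encode a shared)
                               (sym (recolour-second u k v)) (full-below k y<a)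

encoded-separating : ∀ {a} x y z w → y < a → z < a → y ≢ z →
                     encode a (recolour x y z) ≢ encode a (recolour y z w)
encoded-separating {a} x y z w y<a z<a y≢z e
  with shared? (recolour x y z) | shared? (recolour y z w)
... | yes xyz≡ | _ =
  <-irrefl (trans (sym e) (cong (encode a) xyz≡)) (shared-isolated x y z xyz≡ y<a y w)
... | _ | yes yzw≡ =
  <-irrefl (trans e (cong (encode a) yzw≡))
    (shared-isolated w z y (trans (sym (recolour-sym y z w)) yzw≡) z<a x z)
... | no xyz≢ | no yzw≢ = recolour-separating x y z w y≢z (encode-injective a xyz≢ yzw≢ e)

thirdsRule : ∀ a → ThreeWalkRule a (2 * a / 3 + 1)
thirdsRule a = record { rule = rule ; symmetric = symmetric ; separating = separating }
  where
  number : Fin a → Fin a → Fin a → ℕ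
  number x y z = encode a (recolour (toℕ x) (toℕ y) (toℕ z))

  number< : ∀ x y z → number x y z < 2 * a / 3 + 1
  number< x y z = subst (number x y z <_) (+-comm 1 (2 * a / 3))
                    (s≤s (recolour-bound (toℕ x) (toℕ y) (toℕ z) (toℕ<n y)))

  rule : Fin a → Fin a → Fin a → Fin (2 * a / 3 + 1)
  rule x y z = fromℕ< (number< x y z)

  symmetric : ∀ x y z → rule x y z ≡ rule z y x
  symmetric x y z = fromℕ<-cong _ _ (cong (encode a) (recolour-sym (toℕ x) (toℕ y) (toℕ z)))
                      (number< x y z) (number< z y x)

  separating : ∀ x y z w → y ≢ z → rule x y z ≢ rule y z w
  separating x y z w y≢z e =
    encoded-separating (toℕ x) (toℕ y) (toℕ z) (toℕ w) (toℕ<n y) (toℕ<n z)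
      (y≢z ∘ toℕ-injective) (fromℕ<-injective _ _ (number< x y z) (number< y z w) e)

mainTheorem13 : ∀ {n m : ℕ} (G : Graph n m) (ℓ : ℕ) → 2 ≤ ℓ →
                  ∀ (a b : ℕ) → IsChromaticNumber G (ℓ ∸ 2) a → IsChromaticNumber G ℓ b →
                  b ≤ (2 * a) / 3 + 1
mainTheorem13 G (suc (suc ℓ)) _ a b (colouring , _) (_ , minimal) =
  minimal (2 * a / 3 + 1) (liftColouring (thirdsRule a) colouring)
mainTheorem13 G 1 (s≤s ()) _ _ _ _
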